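{- Let $m,n\ge 2$ and let $K_{m,n}\setminus\{e\}$ be the graph obtained from the complete bipartite graph $K_{m,n}$ by deleting one edge $e$. Then the reciprocal distance spectrum of $K_{m,n}\setminus\{e\}$ consists of $-1/2$ with multiplicity $m+n-4$ together with the four roots of the polynomial $$144t^4+(-72m-72n+288)t^3+\big((-108n-108)m-108n+344\big)t^2+\big((-108n-22)m-22n+136\big)t+(21n-41)m-41n+57.$$
   Context: For a connected graph $G$ with vertices $v_1,\dots,v_N$, the reciprocal distance matrix $RD(G)$ has $(i,j)$ entry $1/d(v_i,v_j)$ for $i\ne j$ and $0$ on the diagonal ($d$ the shortest-path distance); its reciprocal distance spectrum is the multiset of its eigenvalues. -}

module Defs where

open import Data.Nat as ℕ using (ℕ; zero; suc)
open import Data.Fin as Fin using (Fin; toℕ; punchIn)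
open import Data.Bool using (Bool; true; false; _∧_; _∨_; not; if_then_else_; _xor_)
open import Data.Integer as ℤ using (+_)
open import Data.Rational as ℚ using (ℚ; 0ℚ; 1ℚ; _+_; _*_; _-_; -_)

Graph : ℕ → Set
Graph N = Fin N → Fin N → Bool

_==_ : ∀ {N} → Fin N → Fin N → Bool
i == j = toℕ i ℕ.≡ᵇ toℕ j

anyFin : ∀ {N} → (Fin N → Bool) → Bool
anyFin {zero}  p = false
anyFin {suc N} p = p Fin.zero ∨ anyFin (λ k → p (Fin.suc k))

reach : ∀ {N} → Graph N → ℕ → Fin N → Fin N → Bool
reach G zero    i j = i == j
reach G (suc k) i j = reach G k i j ∨ anyFin (λ l → reach G k i l ∧ G l j)

search : (ℕ → Bool) → ℕ → ℕ → ℕ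
search p k zero     = k
search p k (suc f)  = if p k then k else search p (suc k) f

-- shortest-path distance d(i,j): the least k with a walk of length ≤ k from i to j.
-- (For a connected graph on N vertices this is found among 0,…,N-1.)
dist : ∀ {N} → Graph N → Fin N → Fin N → ℕ
dist {N} G i j = search (λ k → reach G k i j) 0 N

-- 1/d, with the convention 1/0 ↦ 0 (only used on the diagonal, where d = 0).
recip : ℕ → ℚ
recip zero    = 0ℚ
recip (suc k) = (+ 1) ℚ./ suc k

RD : ∀ {N} → Graph N → Fin N → Fin N → ℚ
RD G i j = if i == j then 0ℚ else recip (dist G i j)

Matrix : ℕ → Set
Matrix n = Fin n → Fin n → ℚ

sumFin : ∀ {n} → (Fin n → ℚ) → ℚ
sumFin {zero}  f = 0ℚ
sumFin {suc n} f = f Fin.zero + sumFin (λ k → f (Fin.suc k))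

sign : ℕ → ℚ
sign zero    = 1ℚ
sign (suc k) = - sign k

minor : ∀ {n} → Matrix (suc n) → Fin (suc n) → Matrix n
minor A j r c = A (Fin.suc r) (punchIn j c)

det : ∀ {n} → Matrix n → ℚ
det {zero}  A = 1ℚ
det {suc n} A = sumFin (λ j → sign (toℕ j) * (A Fin.zero j * det (minor A j)))

charPoly : ∀ {n} → Matrix n → ℚ → ℚ
charPoly A t = det (λ i j → (if i == j then t else 0ℚ) - A i j)

_^_ : ℚ → ℕ → ℚ
x ^ zero  = 1ℚ
x ^ suc k = x * (x ^ k)

-- K_{m,n} minus one edge e. Vertices 0,…,m-1 form one side, m,…,m+n-1 the other;
-- the deleted edge is e = {0, m} (all edges of K_{m,n} are equivalent under automorphisms).
KmnMinusE : (m n : ℕ) → Graph (m ℕ.+ n)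
KmnMinusE m n i j =
  ((toℕ i ℕ.<ᵇ m) xor (toℕ j ℕ.<ᵇ m))
  ∧ not (((toℕ i ℕ.≡ᵇ 0) ∧ (toℕ j ℕ.≡ᵇ m)) ∨ ((toℕ j ℕ.≡ᵇ 0) ∧ (toℕ i ℕ.≡ᵇ m)))

⟦_⟧ : ℕ → ℚ
⟦ k ⟧ = (+ k) ℚ./ 1

quartic : ℕ → ℕ → ℚ → ℚ
quartic m n t =
    ⟦ 144 ⟧ * t ^ 4
  + (- (⟦ 72 ⟧ * ⟦ m ⟧) - ⟦ 72 ⟧ * ⟦ n ⟧ + ⟦ 288 ⟧) * t ^ 3
  + ((- (⟦ 108 ⟧ * ⟦ n ⟧) - ⟦ 108 ⟧) * ⟦ m ⟧ - ⟦ 108 ⟧ * ⟦ n ⟧ + ⟦ 344 ⟧) * t ^ 2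
  + ((- (⟦ 108 ⟧ * ⟦ n ⟧) - ⟦ 22 ⟧) * ⟦ m ⟧ - ⟦ 22 ⟧ * ⟦ n ⟧ + ⟦ 136 ⟧) * t
  + (⟦ 21 ⟧ * ⟦ n ⟧ - ⟦ 41 ⟧) * ⟦ m ⟧ - ⟦ 41 ⟧ * ⟦ n ⟧ + ⟦ 57 ⟧

-- A vertex of K_{m,n} ∖ e has one of four kinds (an end of e or not, on either side), and the
-- distance between two vertices depends only on their kinds. Let W be the matrix of these
-- reciprocal distances, with the same-side value ½ also on the diagonal. Then
-- tI − RD = θI − W with θ = t + ½, and two vertices of equal kind give equal rows and columns
-- of W. Subtracting one such row from the other and expanding twice gives
--   det (θI − W) = 2θ det (θI − W′) − θ² det (θI − W″),
-- where W′, W″ lack one resp. both of the twins. So in m and in n the determinants satisfy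
-- x(k+2) = 2θ x(k+1) − θ² x(k), whose solutions are θ^k times a sequence affine in k; the
-- quartic is affine in m and in n, and four determinants with m, n ≤ 2 fix the constants.
module Submission where

open import Defs
open import Data.Bool using (Bool; true; false; _∧_; _∨_; not; if_then_else_; _xor_)
open import Data.Bool.Properties using (T-≡; ∨-zeroʳ; ∨-conicalˡ; ∨-identityʳ; ∧-zeroʳ; ∧-identityʳ; xor-same; not-distribˡ-xor; not-distribʳ-xor)
open import Data.Empty using (⊥-elim)
open import Data.Fin as Fin using (Fin; zero; suc; toℕ; punchIn; pinch; inject₁; fromℕ; _↑ʳ_)
open import Data.Fin.Properties using (suc-injective; toℕ-injective; toℕ-inject₁; toℕ-fromℕ; toℕ-↑ʳ; punchInᵢ≢i)
open import Data.Integer as ℤ using (+_)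
open import Data.Integer.Tactic.RingSolver as ℤ-Solver using ()
open import Data.Nat as ℕ using (ℕ; zero; suc; _<_; _≤_; _∸_; _<ᵇ_; _≡ᵇ_; s≤s; z≤n)
open import Data.Nat.Properties using (≡ᵇ⇒≡; ≡⇒≡ᵇ; <⇒≤; m<n⇒m<1+n; m∸n+n≡m; +-suc; +-comm; +-identityʳ; m<m+n; m≤n+m; ≤-trans)
open import Data.Rational as ℚ using (ℚ; 0ℚ; 1ℚ; ½; _+_; _*_; _-_; -_)
import Data.Rational.Properties as ℚ
open import Data.Rational.Properties using (+-*-commutativeRing; _≟_; toℚᵘ-injective; toℚᵘ-fromℚᵘ; toℚᵘ-homo-+)
open import Data.Rational.Unnormalised as ℚᵘ using (mkℚᵘ; *≡*)
open import Data.Rational.Unnormalised.Properties as ℚᵘ using (≃-sym)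
open import Data.Vec using ([]; _∷_)
open import Function using (_∘_)
open import Function.Bundles using (Equivalence)
open import Level using (0ℓ)
open import Relation.Binary.PropositionalEquality
open import Relation.Nullary.Decidable.Core using (dec⇒maybe; yes; no)
open import Tactic.RingSolver using (solve-∀)
open import Tactic.RingSolver.Core.AlmostCommutativeRing using (AlmostCommutativeRing; fromCommutativeRing)
open import Tactic.RingSolver.Core.Expression using (Expr; Κ; Ι; _⊕_; _⊗_; ⊝_)

ℚ-ring : AlmostCommutativeRing 0ℓ 0ℓ
ℚ-ring = fromCommutativeRing +-*-commutativeRing (λ x → dec⇒maybe (0ℚ ≟ x))

open import Tactic.RingSolver.NonReflective ℚ-ring using (solve; _⊜_; module Ops)

-- Indices, finite sums and signs

==-refl : ∀ {n} (i : Fin n) → (i == i) ≡ true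
==-refl i = Equivalence.to T-≡ (≡⇒≡ᵇ (toℕ i) (toℕ i) refl)

==⇒≡ : ∀ {n} {i j : Fin n} → (i == j) ≡ true → i ≡ j
==⇒≡ {i = i} {j} eq = toℕ-injective (≡ᵇ⇒≡ (toℕ i) (toℕ j) (Equivalence.from T-≡ eq))

≢⇒==false : ∀ {n} {i j : Fin n} → i ≢ j → (i == j) ≡ false
≢⇒==false {i = i} {j} i≢j with i == j in eq
... | true  = ⊥-elim (i≢j (==⇒≡ eq))
... | false = refl

==-punchIn : ∀ {n} (p : Fin (suc n)) (a b : Fin n) → (punchIn p a == punchIn p b) ≡ (a == b)
==-punchIn zero    a       b       = refl
==-punchIn (suc p) zero    zero    = refl
==-punchIn (suc p) zero    (suc b) = refl
==-punchIn (suc p) (suc a) zero    = refl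
==-punchIn (suc p) (suc a) (suc b) = ==-punchIn p a b

sumFin-cong : ∀ {n} {f g : Fin n → ℚ} → (∀ k → f k ≡ g k) → sumFin f ≡ sumFin g
sumFin-cong {zero}  f≗g = refl
sumFin-cong {suc n} f≗g = cong₂ _+_ (f≗g zero) (sumFin-cong (f≗g ∘ suc))

sumFin-zero : ∀ {n} {f : Fin n → ℚ} → (∀ k → f k ≡ 0ℚ) → sumFin f ≡ 0ℚ
sumFin-zero {zero}  f≗0 = refl
sumFin-zero {suc n} f≗0 = cong₂ _+_ (f≗0 zero) (sumFin-zero (f≗0 ∘ suc))

sumFin-+ : ∀ {n} (f g : Fin n → ℚ) → sumFin (λ k → f k + g k) ≡ sumFin f + sumFin g
sumFin-+ {zero}  f g = refl
sumFin-+ {suc n} f g = trans (cong (λ s → (f zero + g zero) + s) (sumFin-+ (f ∘ suc) (g ∘ suc)))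
                               (+-interchange (f zero) (g zero) _ _)
  where
  +-interchange : ∀ a b s t → (a + b) + (s + t) ≡ (a + s) + (b + t)
  +-interchange = solve-∀ ℚ-ring

*-distribˡ-sumFin : ∀ {n} (x : ℚ) (f : Fin n → ℚ) → x * sumFin f ≡ sumFin (λ k → x * f k)
*-distribˡ-sumFin {zero}  x f = ℚ.*-zeroʳ x
*-distribˡ-sumFin {suc n} x f = trans (ℚ.*-distribˡ-+ x (f zero) _) (cong (λ s → x * f zero + s) (*-distribˡ-sumFin x (f ∘ suc)))

sumFin-remove : ∀ {n} (f : Fin (suc n) → ℚ) (c : Fin (suc n)) → sumFin f ≡ f c + sumFin (f ∘ punchIn c)
sumFin-remove f zero = refl
sumFin-remove {suc n} f (suc c) = trans (cong (λ s → f zero + s) (sumFin-remove (f ∘ suc) c))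
                                          (+-swapˡ (f zero) (f (suc c)) _)
  where
  +-swapˡ : ∀ a b s → a + (b + s) ≡ b + (a + s)
  +-swapˡ = solve-∀ ℚ-ring

sumFin-neg : ∀ {n} (f : Fin n → ℚ) → sumFin (λ k → - f k) ≡ - sumFin f
sumFin-neg {zero}  f = refl
sumFin-neg {suc n} f = trans (cong (λ s → - f zero + s) (sumFin-neg (f ∘ suc))) (sym (ℚ.neg-distrib-+ (f zero) _))

sumFin-linear : ∀ {n} (x y : ℚ) (f g : Fin n → ℚ) →
  sumFin (λ j → x * f j + y * g j) ≡ x * sumFin f + y * sumFin g
sumFin-linear x y f g = trans (sumFin-+ (λ j → x * f j) (λ j → y * g j))
                              (sym (cong₂ _+_ (*-distribˡ-sumFin x f) (*-distribˡ-sumFin y g)))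

sumFin-pairsCancel : ∀ {n} (F : Fin (suc n) → Fin n → ℚ) →
  (∀ j k → F j k ≡ - F (punchIn j k) (pinch k j)) → sumFin (λ j → sumFin (F j)) ≡ 0ℚ
sumFin-pairsCancel {zero}  F anti = refl
sumFin-pairsCancel {suc n} F anti = begin
  sumFin (F zero) + sumFin (λ j → F (suc j) zero + sumFin (λ k → F (suc j) (suc k)))
    ≡⟨ cong (λ s → sumFin (F zero) + s) (sumFin-+ (λ j → F (suc j) zero) (λ j → sumFin (λ k → F (suc j) (suc k)))) ⟩
  sumFin (F zero) + (sumFin (λ j → F (suc j) zero) + inner)
    ≡⟨ cong (λ s → s + (sumFin (λ j → F (suc j) zero) + inner)) (sumFin-cong (anti zero)) ⟩
  sumFin (λ j → - F (suc j) zero) + (sumFin (λ j → F (suc j) zero) + inner)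
    ≡⟨ cong (λ s → s + (sumFin (λ j → F (suc j) zero) + inner)) (sumFin-neg (λ j → F (suc j) zero)) ⟩
  - sumFin (λ j → F (suc j) zero) + (sumFin (λ j → F (suc j) zero) + inner)
    ≡⟨ cancel (sumFin (λ j → F (suc j) zero)) inner ⟩
  inner
    ≡⟨ sumFin-pairsCancel (λ j k → F (suc j) (suc k)) (λ j k → anti (suc j) (suc k)) ⟩
  0ℚ ∎
  where
  open ≡-Reasoning
  inner : ℚ
  inner = sumFin (λ j → sumFin (λ k → F (suc j) (suc k)))
  cancel : ∀ a s → - a + (a + s) ≡ s
  cancel = solve-∀ ℚ-ring

punchIn-punchIn-pinch : ∀ {n} (j : Fin (suc n)) (k : Fin n) → punchIn (punchIn j k) (pinch k j) ≡ j
punchIn-punchIn-pinch zero    zero    = refl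
punchIn-punchIn-pinch zero    (suc k) = refl
punchIn-punchIn-pinch (suc j) zero    = refl
punchIn-punchIn-pinch (suc j) (suc k) = cong suc (punchIn-punchIn-pinch j k)

punchIn-punchIn-comm : ∀ {n} (j : Fin (suc (suc n))) (k : Fin (suc n)) (l : Fin n) →
  punchIn j (punchIn k l) ≡ punchIn (punchIn j k) (punchIn (pinch k j) l)
punchIn-punchIn-comm zero    zero    l       = refl
punchIn-punchIn-comm zero    (suc k) l       = refl
punchIn-punchIn-comm (suc j) zero    l       = refl
punchIn-punchIn-comm (suc j) (suc k) zero    = refl
punchIn-punchIn-comm (suc j) (suc k) (suc l) = cong suc (punchIn-punchIn-comm j k l)

punchIn-inject₁ : ∀ {n} (i k : Fin (suc n)) → k ≢ i → punchIn (inject₁ i) k ≡ punchIn (suc i) k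
punchIn-inject₁ zero    zero    k≢i = ⊥-elim (k≢i refl)
punchIn-inject₁ zero    (suc k) k≢i = refl
punchIn-inject₁ (suc i) zero    k≢i = refl
punchIn-inject₁ {suc n} (suc i) (suc k) k≢i = cong suc (punchIn-inject₁ i k (k≢i ∘ cong suc))

punchIn-inject₁-self : ∀ {n} (i : Fin (suc n)) → punchIn (inject₁ i) i ≡ suc i
punchIn-inject₁-self zero = refl
punchIn-inject₁-self {suc n} (suc i) = cong suc (punchIn-inject₁-self i)

punchIn-suc-self : ∀ {n} (i : Fin (suc n)) → punchIn (suc i) i ≡ inject₁ i
punchIn-suc-self zero = refl
punchIn-suc-self {suc n} (suc i) = cong suc (punchIn-suc-self i)

punchIn-fromℕ : ∀ {N} (a : Fin N) → punchIn (fromℕ N) a ≡ inject₁ a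
punchIn-fromℕ zero    = refl
punchIn-fromℕ (suc a) = cong suc (punchIn-fromℕ a)

sign-+ : ∀ a b → sign (a ℕ.+ b) ≡ sign a * sign b
sign-+ zero    b = sym (ℚ.*-identityˡ (sign b))
sign-+ (suc a) b = trans (cong -_ (sign-+ a b)) (ℚ.neg-distribˡ-* (sign a) (sign b))

neg-*-neg : ∀ a b → - a * - b ≡ a * b
neg-*-neg = solve-∀ ℚ-ring

sign-double : ∀ a → sign (a ℕ.+ a) ≡ 1ℚ
sign-double a = trans (sign-+ a a) (square a)
  where
  square : ∀ a → sign a * sign a ≡ 1ℚ
  square zero    = refl
  square (suc a) = trans (neg-*-neg (sign a) (sign a)) (square a)

sign-punchIn-pinch : ∀ {n} (j : Fin (suc n)) (k : Fin n) →
  sign (toℕ j) * sign (toℕ k) ≡ - (sign (toℕ (punchIn j k)) * sign (toℕ (pinch k j)))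
sign-punchIn-pinch zero    zero    = refl
sign-punchIn-pinch zero    (suc k) = identity (sign (toℕ k))
  where
  identity : ∀ s → 1ℚ * - s ≡ - (- - s * 1ℚ)
  identity = solve-∀ ℚ-ring
sign-punchIn-pinch (suc j) zero    = identity (sign (toℕ j))
  where
  identity : ∀ s → - s * 1ℚ ≡ - (1ℚ * s)
  identity = solve-∀ ℚ-ring
sign-punchIn-pinch (suc j) (suc k) = begin
  - sign (toℕ j) * - sign (toℕ k)                           ≡⟨ neg-*-neg (sign (toℕ j)) (sign (toℕ k)) ⟩
  sign (toℕ j) * sign (toℕ k)                               ≡⟨ sign-punchIn-pinch j k ⟩
  - (sign (toℕ (punchIn j k)) * sign (toℕ (pinch k j)))     ≡⟨ cong -_ (neg-*-neg (sign (toℕ (punchIn j k))) (sign (toℕ (pinch k j)))) ⟨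
  - (- sign (toℕ (punchIn j k)) * - sign (toℕ (pinch k j))) ∎
  where open ≡-Reasoning

-- Determinants

submatrix : ∀ {n} → Matrix (suc n) → Fin (suc n) → Fin (suc n) → Matrix n
submatrix A r c i k = A (punchIn r i) (punchIn c k)

expansionTerm : ∀ {n} → Matrix (suc n) → Fin (suc n) → ℚ
expansionTerm A j = sign (toℕ j) * (A zero j * det (minor A j))

det-cong : ∀ {n} {A B : Matrix n} → (∀ i k → A i k ≡ B i k) → det A ≡ det B
det-cong {zero}  A≗B = refl
det-cong {suc n} A≗B = sumFin-cong λ j →
  cong₂ (λ a d → sign (toℕ j) * (a * d)) (A≗B zero j) (det-cong λ i k → A≗B (suc i) (punchIn j k))

det-linear : ∀ {n} (r : Fin n) (x y : ℚ) {A B C : Matrix n} →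
  (∀ i → i ≢ r → ∀ k → A i k ≡ C i k) → (∀ i → i ≢ r → ∀ k → B i k ≡ C i k) →
  (∀ k → C r k ≡ x * A r k + y * B r k) → det C ≡ x * det A + y * det B
det-linear {suc n} zero x y {A} {B} {C} A≗C B≗C Cᵣ =
  trans (sumFin-cong term) (sumFin-linear x y (expansionTerm A) (expansionTerm B))
  where
  distribute : ∀ x y s a b d → s * ((x * a + y * b) * d) ≡ x * (s * (a * d)) + y * (s * (b * d))
  distribute = solve-∀ ℚ-ring
  term : ∀ j → expansionTerm C j ≡ x * expansionTerm A j + y * expansionTerm B j
  term j = begin
    sign (toℕ j) * (C zero j * det (minor C j))
      ≡⟨ cong (λ c → sign (toℕ j) * (c * det (minor C j))) (Cᵣ j) ⟩
    sign (toℕ j) * ((x * A zero j + y * B zero j) * det (minor C j))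
      ≡⟨ distribute x y (sign (toℕ j)) (A zero j) (B zero j) (det (minor C j)) ⟩
    x * (sign (toℕ j) * (A zero j * det (minor C j))) + y * (sign (toℕ j) * (B zero j * det (minor C j)))
      ≡⟨ cong₂ (λ dA dB → x * (sign (toℕ j) * (A zero j * dA)) + y * (sign (toℕ j) * (B zero j * dB)))
               (det-cong λ i k → sym (A≗C (suc i) (λ ()) (punchIn j k)))
               (det-cong λ i k → sym (B≗C (suc i) (λ ()) (punchIn j k))) ⟩
    x * expansionTerm A j + y * expansionTerm B j ∎
    where open ≡-Reasoning
det-linear {suc n} (suc r) x y {A} {B} {C} A≗C B≗C Cᵣ =
  trans (sumFin-cong term) (sumFin-linear x y (expansionTerm A) (expansionTerm B))
  where
  distribute : ∀ x y s c dA dB → s * (c * (x * dA + y * dB)) ≡ x * (s * (c * dA)) + y * (s * (c * dB))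
  distribute = solve-∀ ℚ-ring
  term : ∀ j → expansionTerm C j ≡ x * expansionTerm A j + y * expansionTerm B j
  term j = begin
    sign (toℕ j) * (C zero j * det (minor C j))
      ≡⟨ cong (λ d → sign (toℕ j) * (C zero j * d))
              (det-linear r x y (λ i i≢r k → A≗C (suc i) (i≢r ∘ suc-injective) (punchIn j k))
                                (λ i i≢r k → B≗C (suc i) (i≢r ∘ suc-injective) (punchIn j k))
                                (λ k → Cᵣ (punchIn j k))) ⟩
    sign (toℕ j) * (C zero j * (x * det (minor A j) + y * det (minor B j)))
      ≡⟨ distribute x y (sign (toℕ j)) (C zero j) (det (minor A j)) (det (minor B j)) ⟩
    x * (sign (toℕ j) * (C zero j * det (minor A j))) + y * (sign (toℕ j) * (C zero j * det (minor B j)))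
      ≡⟨ cong₂ (λ a b → x * (sign (toℕ j) * (a * det (minor A j))) + y * (sign (toℕ j) * (b * det (minor B j))))
               (sym (A≗C zero (λ ()) j)) (sym (B≗C zero (λ ()) j)) ⟩
    x * expansionTerm A j + y * expansionTerm B j ∎
    where open ≡-Reasoning

det-zeroRow : ∀ {n} (r : Fin n) (A : Matrix n) → (∀ k → A r k ≡ 0ℚ) → det A ≡ 0ℚ
det-zeroRow r A Aᵣ≗0 =
  trans (det-linear r 0ℚ 0ℚ (λ _ _ _ → refl) (λ _ _ _ → refl) (λ k → trans (Aᵣ≗0 k) (sym (annihilate (A r k)))))
        (annihilate (det A))
  where
  annihilate : ∀ a → 0ℚ * a + 0ℚ * a ≡ 0ℚ
  annihilate = solve-∀ ℚ-ring

*-*-zeroʳ : ∀ s a → s * (a * 0ℚ) ≡ 0ℚ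
*-*-zeroʳ = solve-∀ ℚ-ring

det-unitRow : ∀ {n} (r c : Fin (suc n)) (A : Matrix (suc n)) → A r c ≡ 1ℚ → (∀ k → A r (punchIn c k) ≡ 0ℚ) →
  det A ≡ sign (toℕ r ℕ.+ toℕ c) * det (submatrix A r c)
det-unitRow zero c A Aᵣ꜀≡1 Aᵣ≗0 = begin
  sumFin (expansionTerm A)                                 ≡⟨ sumFin-remove (expansionTerm A) c ⟩
  expansionTerm A c + sumFin (expansionTerm A ∘ punchIn c) ≡⟨ cong₂ _+_ pivot (sumFin-zero others) ⟩
  sign (toℕ c) * (1ℚ * det (minor A c)) + 0ℚ               ≡⟨ unit (sign (toℕ c)) (det (minor A c)) ⟩
  sign (toℕ c) * det (submatrix A zero c)                  ∎
  where
  open ≡-Reasoning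
  unit : ∀ s d → s * (1ℚ * d) + 0ℚ ≡ s * d
  unit = solve-∀ ℚ-ring
  annihilate : ∀ s d → s * (0ℚ * d) ≡ 0ℚ
  annihilate = solve-∀ ℚ-ring
  pivot : expansionTerm A c ≡ sign (toℕ c) * (1ℚ * det (minor A c))
  pivot = cong (λ a → sign (toℕ c) * (a * det (minor A c))) Aᵣ꜀≡1
  others : ∀ k → expansionTerm A (punchIn c k) ≡ 0ℚ
  others k = trans (cong (λ a → sign (toℕ (punchIn c k)) * (a * det (minor A (punchIn c k)))) (Aᵣ≗0 k))
                   (annihilate (sign (toℕ (punchIn c k))) (det (minor A (punchIn c k))))
det-unitRow {suc n} (suc r) c A Aᵣ꜀≡1 Aᵣ≗0 = begin
  sumFin (expansionTerm A)                                          ≡⟨ sumFin-remove (expansionTerm A) c ⟩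
  expansionTerm A c + sumFin (expansionTerm A ∘ punchIn c)          ≡⟨ cong₂ _+_ vanishing (sumFin-cong shifted) ⟩
  0ℚ + sumFin (λ k → sign (toℕ (suc r) ℕ.+ toℕ c) * expansionTerm S k) ≡⟨ ℚ.+-identityˡ _ ⟩
  sumFin (λ k → sign (toℕ (suc r) ℕ.+ toℕ c) * expansionTerm S k)   ≡⟨ *-distribˡ-sumFin (sign (toℕ (suc r) ℕ.+ toℕ c)) (expansionTerm S) ⟨
  sign (toℕ (suc r) ℕ.+ toℕ c) * det S                              ∎
  where
  open ≡-Reasoning
  S : Matrix (suc n)
  S = submatrix A (suc r) c
  vanishing : expansionTerm A c ≡ 0ℚ
  vanishing = trans (cong (λ d → sign (toℕ c) * (A zero c * d)) (det-zeroRow r (minor A c) Aᵣ≗0))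
                    (*-*-zeroʳ (sign (toℕ c)) (A zero c))
  regroup : ∀ u v w x y a d → x * y ≡ - (u * w) → u * (a * ((v * w) * d)) ≡ - (v * x) * (y * (a * d))
  regroup u v w x y a d xy≡-uw = begin
    u * (a * ((v * w) * d))  ≡⟨ rearrange₁ u v w a d ⟩
    - (v * (a * d)) * - (u * w) ≡⟨ cong (λ z → - (v * (a * d)) * z) xy≡-uw ⟨
    - (v * (a * d)) * (x * y) ≡⟨ rearrange₂ v x y a d ⟩
    - (v * x) * (y * (a * d)) ∎
    where
    rearrange₁ : ∀ u v w a d → u * (a * ((v * w) * d)) ≡ - (v * (a * d)) * - (u * w)
    rearrange₁ = solve-∀ ℚ-ring
    rearrange₂ : ∀ v x y a d → - (v * (a * d)) * (x * y) ≡ - (v * x) * (y * (a * d))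
    rearrange₂ = solve-∀ ℚ-ring
  shifted : ∀ k → expansionTerm A (punchIn c k) ≡ sign (toℕ (suc r) ℕ.+ toℕ c) * expansionTerm S k
  shifted k = begin
    sign (toℕ (punchIn c k)) * (A zero (punchIn c k) * det (minor A (punchIn c k)))
      ≡⟨ cong (λ d → sign (toℕ (punchIn c k)) * (A zero (punchIn c k) * d))
              (det-unitRow r (pinch k c) (minor A (punchIn c k))
                 (trans (cong (A (suc r)) (punchIn-punchIn-pinch c k)) Aᵣ꜀≡1)
                 (λ l → trans (cong (A (suc r)) (sym (punchIn-punchIn-comm c k l))) (Aᵣ≗0 (punchIn k l)))) ⟩
    sign (toℕ (punchIn c k)) * (A zero (punchIn c k) * (sign (toℕ r ℕ.+ toℕ (pinch k c)) * det (submatrix (minor A (punchIn c k)) r (pinch k c))))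
      ≡⟨ cong₂ (λ s d → sign (toℕ (punchIn c k)) * (A zero (punchIn c k) * (s * d)))
               (sign-+ (toℕ r) (toℕ (pinch k c)))
               (det-cong λ a l → cong (A (suc (punchIn r a))) (sym (punchIn-punchIn-comm c k l))) ⟩
    sign (toℕ (punchIn c k)) * (A zero (punchIn c k) * ((sign (toℕ r) * sign (toℕ (pinch k c))) * det (minor S k)))
      ≡⟨ regroup (sign (toℕ (punchIn c k))) (sign (toℕ r)) (sign (toℕ (pinch k c))) (sign (toℕ c)) (sign (toℕ k))
                 (A zero (punchIn c k)) (det (minor S k)) (sign-punchIn-pinch c k) ⟩
    - (sign (toℕ r) * sign (toℕ c)) * (sign (toℕ k) * (S zero k * det (minor S k)))
      ≡⟨ cong (λ s → - s * expansionTerm S k) (sign-+ (toℕ r) (toℕ c)) ⟨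
    sign (toℕ (suc r) ℕ.+ toℕ c) * expansionTerm S k ∎

-- In the double expansion along rows 0 and 1, the term for columns (j, punchIn j k) cancels the
-- term for the same two columns taken in the other order, (punchIn j k, pinch k j).
det-adjacentEqualRows : ∀ {n} (i : Fin (suc n)) (A : Matrix (suc (suc n))) →
  (∀ k → A (inject₁ i) k ≡ A (suc i) k) → det A ≡ 0ℚ
det-adjacentEqualRows {n} zero A A₀≗A₁ =
  trans (sumFin-cong expand) (sumFin-pairsCancel F anti)
  where
  D : Fin (suc (suc n)) → Fin (suc n) → ℚ
  D j k = det (minor (minor A j) k)
  F : Fin (suc (suc n)) → Fin (suc n) → ℚ
  F j k = sign (toℕ j) * (A zero j * (sign (toℕ k) * (A (suc zero) (punchIn j k) * D j k)))
  expand : ∀ j → expansionTerm A j ≡ sumFin (F j)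
  expand j = trans (cong (sign (toℕ j) *_) (*-distribˡ-sumFin (A zero j) (λ k → sign (toℕ k) * (A (suc zero) (punchIn j k) * D j k))))
                   (*-distribˡ-sumFin (sign (toℕ j)) (λ k → A zero j * (sign (toℕ k) * (A (suc zero) (punchIn j k) * D j k))))
  swap : ∀ sⱼ sₖ s s′ a b d → sⱼ * sₖ ≡ - (s * s′) → sⱼ * (a * (sₖ * (b * d))) ≡ - (s * (b * (s′ * (a * d))))
  swap sⱼ sₖ s s′ a b d h = begin
    sⱼ * (a * (sₖ * (b * d))) ≡⟨ rearrange₁ sⱼ sₖ a b d ⟩
    (sⱼ * sₖ) * (a * b * d)   ≡⟨ cong (_* (a * b * d)) h ⟩
    - (s * s′) * (a * b * d)  ≡⟨ rearrange₂ s s′ a b d ⟩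
    - (s * (b * (s′ * (a * d)))) ∎
    where
    open ≡-Reasoning
    rearrange₁ : ∀ sⱼ sₖ a b d → sⱼ * (a * (sₖ * (b * d))) ≡ (sⱼ * sₖ) * (a * b * d)
    rearrange₁ = solve-∀ ℚ-ring
    rearrange₂ : ∀ s s′ a b d → - (s * s′) * (a * b * d) ≡ - (s * (b * (s′ * (a * d))))
    rearrange₂ = solve-∀ ℚ-ring
  anti : ∀ j k → F j k ≡ - F (punchIn j k) (pinch k j)
  anti j k = begin
    F j k
      ≡⟨ cong (λ b → sign (toℕ j) * (A zero j * (sign (toℕ k) * (b * D j k)))) (sym (A₀≗A₁ (punchIn j k))) ⟩
    sign (toℕ j) * (A zero j * (sign (toℕ k) * (A zero (punchIn j k) * D j k)))
      ≡⟨ swap (sign (toℕ j)) (sign (toℕ k)) (sign (toℕ (punchIn j k))) (sign (toℕ (pinch k j)))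
              (A zero j) (A zero (punchIn j k)) (D j k) (sign-punchIn-pinch j k) ⟩
    - (sign (toℕ (punchIn j k)) * (A zero (punchIn j k) * (sign (toℕ (pinch k j)) * (A zero j * D j k))))
      ≡⟨ cong₂ (λ a d → - (sign (toℕ (punchIn j k)) * (A zero (punchIn j k) * (sign (toℕ (pinch k j)) * (a * d)))))
               (trans (A₀≗A₁ j) (cong (A (suc zero)) (sym (punchIn-punchIn-pinch j k))))
               (det-cong λ r l → cong (A (suc (suc r))) (punchIn-punchIn-comm j k l)) ⟩
    - F (punchIn j k) (pinch k j) ∎
    where open ≡-Reasoning
det-adjacentEqualRows {suc n} (suc i) A Aᵢ≗Aᵢ₊₁ = sumFin-zero λ j →
  trans (cong (λ d → sign (toℕ j) * (A zero j * d)) (det-adjacentEqualRows i (minor A j) (λ k → Aᵢ≗Aᵢ₊₁ (punchIn j k))))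
        (*-*-zeroʳ (sign (toℕ j)) (A zero j))

basis : ∀ {n} → Fin n → Fin n → ℚ
basis c k = if c == k then 1ℚ else 0ℚ

shift : ∀ {n} → ℚ → Matrix n → Matrix n
shift c B i k = c * basis i k + B i k

setRow : ∀ {n} → Matrix n → Fin n → (Fin n → ℚ) → Matrix n
setRow A r v i = if i == r then v else A i

setRow-same : ∀ {n} (A : Matrix n) r v k → setRow A r v r k ≡ v k
setRow-same A r v k rewrite ==-refl r = refl

setRow-other : ∀ {n} (A : Matrix n) r v {i} → i ≢ r → ∀ k → setRow A r v i k ≡ A i k
setRow-other A r v i≢r k rewrite ≢⇒==false i≢r = refl

setRow-self : ∀ {n} (A : Matrix n) r i k → setRow A r (A r) i k ≡ A i k
setRow-self A r i k with i == r in eq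
... | true  = cong (λ j → A j k) (sym (==⇒≡ eq))
... | false = refl

submatrix-shift : ∀ {n} (c : ℚ) (B : Matrix (suc n)) p a k → submatrix (shift c B) p p a k ≡ shift c (submatrix B p p) a k
submatrix-shift c B p a k rewrite ==-punchIn p a k = refl

det-addBasis : ∀ {n} (r c : Fin (suc n)) (x : ℚ) (A : Matrix (suc n)) (v : Fin (suc n) → ℚ) →
  det (setRow A r (λ k → v k + x * basis c k)) ≡ det (setRow A r v) + x * (sign (toℕ r ℕ.+ toℕ c) * det (submatrix A r c))
det-addBasis r c x A v = begin
  det (setRow A r (λ k → v k + x * basis c k))
    ≡⟨ det-linear r 1ℚ x (λ i i≢r k → trans (setRow-other A r v i≢r k) (sym (setRow-other A r _ i≢r k)))
                           (λ i i≢r k → trans (setRow-other A r (basis c) i≢r k) (sym (setRow-other A r _ i≢r k)))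
                           (λ k → trans (setRow-same A r _ k)
                                        (cong₂ (λ a b → a + x * b) (sym (trans (ℚ.*-identityˡ _) (setRow-same A r v k)))
                                                                   (sym (setRow-same A r (basis c) k)))) ⟩
  1ℚ * det (setRow A r v) + x * det (setRow A r (basis c))
    ≡⟨ cong₂ (λ a b → a + x * b) (ℚ.*-identityˡ (det (setRow A r v))) unitRow ⟩
  det (setRow A r v) + x * (sign (toℕ r ℕ.+ toℕ c) * det (submatrix A r c)) ∎
  where
  open ≡-Reasoning
  unitRow : det (setRow A r (basis c)) ≡ sign (toℕ r ℕ.+ toℕ c) * det (submatrix A r c)
  unitRow = trans (det-unitRow r c (setRow A r (basis c))
                     (trans (setRow-same A r (basis c) c) (cong (if_then 1ℚ else 0ℚ) (==-refl c)))
                     (λ k → trans (setRow-same A r (basis c) (punchIn c k))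
                                  (cong (if_then 1ℚ else 0ℚ) (≢⇒==false (punchInᵢ≢i c k ∘ sym)))))
                  (cong (sign (toℕ r ℕ.+ toℕ c) *_)
                     (det-cong λ a k → setRow-other A r (basis c) (punchInᵢ≢i r a) (punchIn c k)))

setRow-≗ : ∀ {n} (A : Matrix n) r v → (∀ k → A r k ≡ v k) → ∀ a k → A a k ≡ setRow A r v a k
setRow-≗ A r v Aᵣ≗v a k with a == r in eq
... | true  = trans (cong (λ j → A j k) (==⇒≡ eq)) (Aᵣ≗v k)
... | false = refl

-- Columns inject₁ i and suc i of B agree, so once row suc i of cI + B is struck out, striking
-- column inject₁ i instead of suc i only removes the c at position (i, i).
det-strikeTwinColumn : ∀ {n} (c : ℚ) (B : Matrix (suc (suc n))) (i : Fin (suc n)) →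
  (∀ k → B k (inject₁ i) ≡ B k (suc i)) →
  det (submatrix (shift c B) (suc i) (inject₁ i))
    ≡ det (submatrix (shift c B) (suc i) (suc i))
      + - c * (1ℚ * det (submatrix (submatrix (shift c B) (suc i) (suc i)) i i))
det-strikeTwinColumn c B i colTwin = begin
  det C                                                                            ≡⟨ det-cong stripped ⟩
  det (setRow M i (λ k → M i k + - c * basis i k))                                 ≡⟨ det-addBasis i i (- c) M (M i) ⟩
  det (setRow M i (M i)) + - c * (sign (toℕ i ℕ.+ toℕ i) * det (submatrix M i i))
    ≡⟨ cong₂ (λ d s → d + - c * (s * det (submatrix M i i))) (det-cong (setRow-self M i)) (sign-double (toℕ i)) ⟩
  det M + - c * (1ℚ * det (submatrix M i i))                                       ∎
  where
  open ≡-Reasoning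
  i₀ i₁ : Fin (suc (suc _))
  i₀ = inject₁ i
  i₁ = suc i
  A : Matrix (suc (suc _))
  A = shift c B
  M C : Matrix (suc _)
  M = submatrix A i₁ i₁
  C = submatrix A i₁ i₀
  columnsAgree : ∀ x k → B x (punchIn i₀ k) ≡ B x (punchIn i₁ k)
  columnsAgree x k with k Fin.≟ i
  ... | yes refl = trans (cong (B x) (punchIn-inject₁-self i))
                         (sym (trans (cong (B x) (punchIn-suc-self i)) (colTwin x)))
  ... | no k≢i  = cong (B x) (punchIn-inject₁ i k k≢i)
  C-columnᵢ : ∀ a → C a i ≡ c * 0ℚ + B (punchIn i₁ a) (punchIn i₁ i)
  C-columnᵢ a = begin
    C a i
      ≡⟨ cong (A (punchIn i₁ a)) (punchIn-inject₁-self i) ⟩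
    c * basis (punchIn i₁ a) i₁ + B (punchIn i₁ a) i₁
      ≡⟨ cong₂ (λ b x → c * (if b then 1ℚ else 0ℚ) + x) (≢⇒==false (punchInᵢ≢i i₁ a))
               (trans (cong (B (punchIn i₁ a)) (sym (punchIn-inject₁-self i))) (columnsAgree (punchIn i₁ a) i)) ⟩
    c * 0ℚ + B (punchIn i₁ a) (punchIn i₁ i) ∎
  dropDiagonal : ∀ c b → c * 0ℚ + b ≡ c * 1ℚ + b + - c * 1ℚ
  dropDiagonal = solve-∀ ℚ-ring
  keep : ∀ c x → x ≡ x + - c * 0ℚ
  keep = solve-∀ ℚ-ring
  stripped : ∀ a k → C a k ≡ setRow M i (λ k → M i k + - c * basis i k) a k
  stripped a k with k Fin.≟ i | a == i in eq
  ... | yes refl | true  = begin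
    C a i                                          ≡⟨ cong (λ x → C x i) (==⇒≡ {i = a} {j = i} eq) ⟩
    C i i                                          ≡⟨ C-columnᵢ i ⟩
    c * 0ℚ + B (punchIn i₁ i) (punchIn i₁ i)       ≡⟨ dropDiagonal c _ ⟩
    c * 1ℚ + B (punchIn i₁ i) (punchIn i₁ i) + - c * 1ℚ
      ≡⟨ cong₂ (λ p q → c * (if p then 1ℚ else 0ℚ) + B (punchIn i₁ i) (punchIn i₁ i) + - c * (if q then 1ℚ else 0ℚ))
               (==-refl (punchIn i₁ i)) (==-refl i) ⟨
    M i i + - c * basis i i                        ∎
  ... | yes refl | false = trans (C-columnᵢ a)
    (cong (λ p → c * (if p then 1ℚ else 0ℚ) + B (punchIn i₁ a) (punchIn i₁ i)) (sym (trans (==-punchIn i₁ a i) eq)))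
  ... | no k≢i   | true  = begin
    C a k                   ≡⟨ cong (λ x → C x k) (==⇒≡ {i = a} {j = i} eq) ⟩
    C i k                   ≡⟨ cong (A (punchIn i₁ i)) (punchIn-inject₁ i k k≢i) ⟩
    M i k                   ≡⟨ keep c (M i k) ⟩
    M i k + - c * 0ℚ        ≡⟨ cong (λ p → M i k + - c * (if p then 1ℚ else 0ℚ)) (≢⇒==false (k≢i ∘ sym)) ⟨
    M i k + - c * basis i k ∎
  ... | no k≢i   | false = cong (A (punchIn i₁ a)) (punchIn-inject₁ i k k≢i)

-- Row suc i minus row inject₁ i of cI + B is c (e_{suc i} − e_{inject₁ i}); expanding along it
-- gives c det M + c det C, where M and C strike row suc i and column suc i resp. inject₁ i.
det-twins : ∀ {n} (c : ℚ) (B : Matrix (suc (suc n))) (i : Fin (suc n)) →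
  (∀ k → B (inject₁ i) k ≡ B (suc i) k) → (∀ k → B k (inject₁ i) ≡ B k (suc i)) →
  det (shift c B) ≡ (c + c) * det (shift c (submatrix B (suc i) (suc i)))
                    - (c * c) * det (shift c (submatrix (submatrix B (suc i) (suc i)) i i))
det-twins c B i rowTwin colTwin = begin
  det A
    ≡⟨ det-cong (setRow-≗ A i₁ _ difference) ⟩
  det (setRow A i₁ (λ k → (A i₀ k + c * basis i₁ k) + - c * basis i₀ k))
    ≡⟨ det-addBasis i₁ i₀ (- c) A (λ k → A i₀ k + c * basis i₁ k) ⟩
  det (setRow A i₁ (λ k → A i₀ k + c * basis i₁ k)) + - c * (sign (toℕ i₁ ℕ.+ toℕ i₀) * det C)
    ≡⟨ cong₂ (λ d s → d + - c * (s * det C)) (det-addBasis i₁ i₁ c A (A i₀)) sign₁₀ ⟩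
  (det (setRow A i₁ (A i₀)) + c * (sign (toℕ i₁ ℕ.+ toℕ i₁) * det M)) + - c * (- 1ℚ * det C)
    ≡⟨ cong₂ (λ d s → (d + c * (s * det M)) + - c * (- 1ℚ * det C)) repeated (sign-double (toℕ i₁)) ⟩
  (0ℚ + c * (1ℚ * det M)) + - c * (- 1ℚ * det C)
    ≡⟨ cong (λ d → (0ℚ + c * (1ℚ * det M)) + - c * (- 1ℚ * d)) (det-strikeTwinColumn c B i colTwin) ⟩
  (0ℚ + c * (1ℚ * det M)) + - c * (- 1ℚ * (det M + - c * (1ℚ * det (submatrix M i i))))
    ≡⟨ collect c (det M) (det (submatrix M i i)) ⟩
  (c + c) * det M - (c * c) * det (submatrix M i i)
    ≡⟨ cong₂ (λ d d′ → (c + c) * d - (c * c) * d′)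
             (det-cong (submatrix-shift c B i₁))
             (det-cong λ a k → trans (submatrix-shift c B i₁ (punchIn i a) (punchIn i k))
                                     (submatrix-shift c (submatrix B i₁ i₁) i a k)) ⟩
  (c + c) * det (shift c (submatrix B i₁ i₁)) - (c * c) * det (shift c (submatrix (submatrix B i₁ i₁) i i)) ∎
  where
  open ≡-Reasoning
  i₀ i₁ : Fin (suc (suc _))
  i₀ = inject₁ i
  i₁ = suc i
  A : Matrix (suc (suc _))
  A = shift c B
  M C : Matrix (suc _)
  M = submatrix A i₁ i₁
  C = submatrix A i₁ i₀
  rearrange : ∀ c e₁ e₀ b → c * e₁ + b ≡ ((c * e₀ + b) + c * e₁) + - c * e₀
  rearrange = solve-∀ ℚ-ring
  difference : ∀ k → A i₁ k ≡ (A i₀ k + c * basis i₁ k) + - c * basis i₀ k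
  difference k = trans (cong (λ s → c * basis i₁ k + s) (sym (rowTwin k)))
                       (rearrange c (basis i₁ k) (basis i₀ k) (B i₀ k))
  repeated : det (setRow A i₁ (A i₀)) ≡ 0ℚ
  repeated = det-adjacentEqualRows i (setRow A i₁ (A i₀))
               (λ k → trans (setRow-other A i₁ (A i₀) (punchInᵢ≢i i₁ i ∘ trans (punchIn-suc-self i)) k)
                            (sym (setRow-same A i₁ (A i₀) k)))
  sign₁₀ : sign (toℕ i₁ ℕ.+ toℕ i₀) ≡ - 1ℚ
  sign₁₀ = trans (cong (λ k → - sign (toℕ i ℕ.+ k)) (toℕ-inject₁ i)) (cong -_ (sign-double (toℕ i)))
  collect : ∀ c d d′ → (0ℚ + c * (1ℚ * d)) + - c * (- 1ℚ * (d + - c * (1ℚ * d′))) ≡ (c + c) * d - (c * c) * d′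
  collect = solve-∀ ℚ-ring

-- Matrices that are constant on blocks of equal kind

-- Up to automorphism, a vertex of K_{m,n} ∖ e is determined by its side and by whether it is
-- the end 0 ∈ X or the end m ∈ Y of the deleted edge.
record Kind : Set where
  constructor kind
  field
    inX isX₀ isY₀ : Bool
open Kind

kindOf : ℕ → ℕ → Kind
kindOf m x = kind (x <ᵇ m) (x ≡ᵇ 0) (x ≡ᵇ m)

adjacent : Kind → Kind → Bool
adjacent κ κ′ = (inX κ xor inX κ′) ∧ not ((isX₀ κ ∧ isY₀ κ′) ∨ (isX₀ κ′ ∧ isY₀ κ))

kindDist : Kind → Kind → ℕ
kindDist κ κ′ = if adjacent κ κ′ then 1 else if inX κ xor inX κ′ then 3 else 2

-- The diagonal holds −½ (the same-side value) instead of 0, so vertices of equal kind give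
-- equal rows and columns.
kindPattern : ∀ {N} → (Fin N → Kind) → Matrix N
kindPattern τ i j = - recip (kindDist (τ i) (τ j))

<ᵇ-false : ∀ {m x} → m ≤ x → (x <ᵇ m) ≡ false
<ᵇ-false {zero}  _         = refl
<ᵇ-false {suc m} (s≤s m≤x) = <ᵇ-false m≤x

≡ᵇ-false : ∀ {m x} → m < x → (x ≡ᵇ m) ≡ false
≡ᵇ-false {zero}  (s≤s _)   = refl
≡ᵇ-false {suc m} (s≤s m<x) = ≡ᵇ-false m<x

ordinaryY : Kind
ordinaryY = kind false false false

kindOf-beyond : ∀ {m x} → m < x → kindOf m x ≡ ordinaryY
kindOf-beyond {x = suc x} m<x = cong₂ (λ a c → kind a false c) (<ᵇ-false (<⇒≤ m<x)) (≡ᵇ-false m<x)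

kindOf-punchIn : ∀ {N} m (p a : Fin N) → toℕ p < m → kindOf (suc m) (toℕ (punchIn (suc p) a)) ≡ kindOf m (toℕ a)
kindOf-punchIn (suc m) p       zero    _         = refl
kindOf-punchIn m       zero    (suc a) _         = refl
kindOf-punchIn (suc m) (suc p) (suc a) (s≤s p<m) =
  cong (λ κ → kind (inX κ) false (isY₀ κ)) (kindOf-punchIn m p a p<m)

kindOf-punchIn-last : ∀ {N} m (a : Fin N) → kindOf m (toℕ (punchIn (fromℕ N) a)) ≡ kindOf m (toℕ a)
kindOf-punchIn-last m a = cong (kindOf m) (trans (cong toℕ (punchIn-fromℕ a)) (toℕ-inject₁ a))

det-pattern-cong : ∀ {N} (c : ℚ) (τ σ : Fin N → Kind) → (∀ a → τ a ≡ σ a) →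
  det (shift c (kindPattern τ)) ≡ det (shift c (kindPattern σ))
det-pattern-cong c τ σ τ≗σ = det-cong λ a k → cong₂ (λ κ κ′ → c * basis a k + - recip (kindDist κ κ′)) (τ≗σ a) (τ≗σ k)

det-kindTwins : ∀ {N} (c : ℚ) (τ : Fin (suc (suc N)) → Kind) (i : Fin (suc N)) → τ (inject₁ i) ≡ τ (suc i) →
  det (shift c (kindPattern τ)) ≡ (c + c) * det (shift c (kindPattern (τ ∘ punchIn (suc i))))
                              - (c * c) * det (shift c (kindPattern (τ ∘ punchIn (suc i) ∘ punchIn i)))
det-kindTwins c τ i twins = det-twins c (kindPattern τ) i
  (λ k → cong (λ κ → - recip (kindDist κ (τ k))) twins)
  (λ k → cong (λ κ → - recip (kindDist (τ k) κ)) twins)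

θ : ℚ → ℚ
θ t = t + ½

-- det (tI − RD) for the distance pattern of K_{m,n} ∖ e on N vertices, the first m of them forming X.
χ′ : ℕ → (N : ℕ) → ℚ → ℚ
χ′ m N t = det (shift (θ t) (kindPattern {N} (kindOf m ∘ toℕ)))

χ′-recurrenceX : ∀ m N t → χ′ (3 ℕ.+ m) (3 ℕ.+ N) t ≡ (θ t + θ t) * χ′ (2 ℕ.+ m) (2 ℕ.+ N) t - (θ t * θ t) * χ′ (1 ℕ.+ m) (1 ℕ.+ N) t
χ′-recurrenceX m N t = trans (det-kindTwins (θ t) τ (suc zero) refl)
  (cong₂ (λ d d′ → (θ t + θ t) * d - (θ t * θ t) * d′)
     (det-pattern-cong (θ t) (τ ∘ punchIn (suc (suc zero))) (kindOf (2 ℕ.+ m) ∘ toℕ)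
        λ a → kindOf-punchIn (2 ℕ.+ m) (suc zero) a (s≤s (s≤s z≤n)))
     (det-pattern-cong (θ t) (τ ∘ punchIn (suc (suc zero)) ∘ punchIn (suc zero)) (kindOf (1 ℕ.+ m) ∘ toℕ)
        λ a → trans (kindOf-punchIn (2 ℕ.+ m) (suc zero) (punchIn (suc zero) a) (s≤s (s≤s z≤n)))
                    (kindOf-punchIn (1 ℕ.+ m) zero a (s≤s z≤n))))
  where
  τ : Fin (3 ℕ.+ N) → Kind
  τ = kindOf (3 ℕ.+ m) ∘ toℕ

χ′-recurrenceY : ∀ m N t → m < N → χ′ m (2 ℕ.+ N) t ≡ (θ t + θ t) * χ′ m (1 ℕ.+ N) t - (θ t * θ t) * χ′ m N t
χ′-recurrenceY m N t m<N = trans (det-kindTwins (θ t) τ (fromℕ N) twins)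
  (cong₂ (λ d d′ → (θ t + θ t) * d - (θ t * θ t) * d′)
     (det-pattern-cong (θ t) (τ ∘ punchIn (fromℕ (suc N))) (kindOf m ∘ toℕ) (kindOf-punchIn-last m))
     (det-pattern-cong (θ t) (τ ∘ punchIn (fromℕ (suc N)) ∘ punchIn (fromℕ N)) (kindOf m ∘ toℕ)
        λ a → trans (kindOf-punchIn-last m (punchIn (fromℕ N) a)) (kindOf-punchIn-last m a)))
  where
  τ : Fin (2 ℕ.+ N) → Kind
  τ = kindOf m ∘ toℕ
  twins : kindOf m (toℕ (inject₁ (fromℕ N))) ≡ kindOf m (suc (toℕ (fromℕ N)))
  twins = trans (kindOf-beyond (subst (m <_) (sym (trans (toℕ-inject₁ (fromℕ N)) (toℕ-fromℕ N))) m<N))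
                (sym (kindOf-beyond (subst (m <_) (sym (cong suc (toℕ-fromℕ N))) (m<n⇒m<1+n m<N))))

-- The closed form

-- Formal counterparts of det and quartic: they evaluate definitionally to the originals, so the
-- non-reflective ring solver decides polynomial identities stated through them.
infixl 6 _⊖_
_⊖_ : ∀ {k} → Expr ℚ k → Expr ℚ k → Expr ℚ k
x ⊖ y = x ⊕ ⊝ y

powᴱ : ∀ {k} → Expr ℚ k → ℕ → Expr ℚ k
powᴱ e ℕ.zero    = Κ 1ℚ
powᴱ e (ℕ.suc i) = e ⊗ powᴱ e i

quarticᴱ : ∀ {k} → Expr ℚ k → Expr ℚ k → Expr ℚ k → Expr ℚ k
quarticᴱ M N t =
    Κ ⟦ 144 ⟧ ⊗ powᴱ t 4
  ⊕ (⊝ (Κ ⟦ 72 ⟧ ⊗ M) ⊖ Κ ⟦ 72 ⟧ ⊗ N ⊕ Κ ⟦ 288 ⟧) ⊗ powᴱ t 3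
  ⊕ ((⊝ (Κ ⟦ 108 ⟧ ⊗ N) ⊖ Κ ⟦ 108 ⟧) ⊗ M ⊖ Κ ⟦ 108 ⟧ ⊗ N ⊕ Κ ⟦ 344 ⟧) ⊗ powᴱ t 2
  ⊕ ((⊝ (Κ ⟦ 108 ⟧ ⊗ N) ⊖ Κ ⟦ 22 ⟧) ⊗ M ⊖ Κ ⟦ 22 ⟧ ⊗ N ⊕ Κ ⟦ 136 ⟧) ⊗ t
  ⊕ (Κ ⟦ 21 ⟧ ⊗ N ⊖ Κ ⟦ 41 ⟧) ⊗ M ⊖ Κ ⟦ 41 ⟧ ⊗ N ⊕ Κ ⟦ 57 ⟧

quarticℚ : ℚ → ℚ → ℚ → ℚ
quarticℚ M N t = Ops.⟦ quarticᴱ (Ι zero) (Ι (suc zero)) (Ι (suc (suc zero))) ⟧ (M ∷ N ∷ t ∷ [])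

sumᴱ : ∀ {m k} → (Fin m → Expr ℚ k) → Expr ℚ k
sumᴱ {zero}  f = Κ 0ℚ
sumᴱ {suc m} f = f zero ⊕ sumᴱ (f ∘ suc)

signᴱ : ∀ {k} → ℕ → Expr ℚ k
signᴱ zero    = Κ 1ℚ
signᴱ (suc i) = ⊝ signᴱ i

detᴱ : ∀ {m k} → (Fin m → Fin m → Expr ℚ k) → Expr ℚ k
detᴱ {zero}  A = Κ 1ℚ
detᴱ {suc m} A = sumᴱ (λ j → signᴱ (toℕ j) ⊗ (A zero j ⊗ detᴱ (λ r c → A (suc r) (punchIn j c))))

χ : ℕ → ℕ → ℚ → ℚ
χ m n = χ′ m (m ℕ.+ n)

Q : ℕ → ℕ → ℚ → ℚ
Q m n t = quartic m n t * ((+ 1) ℚ./ 144)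

⟦suc⟧ : ∀ k → ⟦ suc k ⟧ ≡ ⟦ k ⟧ + 1ℚ
⟦suc⟧ k = toℚᵘ-injective (begin
  ℚ.toℚᵘ ⟦ suc k ⟧                         ≈⟨ toℚᵘ-fromℚᵘ (mkℚᵘ (+ suc k) 0) ⟩
  mkℚᵘ (+ suc k) 0                         ≈⟨ *≡* (integerIdentity (+ k)) ⟩
  mkℚᵘ (+ k) 0 ℚᵘ.+ mkℚᵘ (+ 1) 0           ≈⟨ ℚᵘ.+-cong (≃-sym (toℚᵘ-fromℚᵘ (mkℚᵘ (+ k) 0))) ℚᵘ.≃-refl ⟩
  ℚ.toℚᵘ ⟦ k ⟧ ℚᵘ.+ ℚ.toℚᵘ 1ℚ              ≈⟨ toℚᵘ-homo-+ ⟦ k ⟧ 1ℚ ⟨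
  ℚ.toℚᵘ (⟦ k ⟧ + 1ℚ)                      ∎)
  where
  open ℚᵘ.≃-Reasoning
  integerIdentity : ∀ x → (+ 1 ℤ.+ x) ℤ.* (+ 1 ℤ.* + 1) ≡ (x ℤ.* + 1 ℤ.+ + 1 ℤ.* + 1) ℤ.* + 1
  integerIdentity = ℤ-Solver.solve-∀

⟦2+⟧ : ∀ k → ⟦ 2 ℕ.+ k ⟧ ≡ ⟦ k ⟧ + 1ℚ + 1ℚ
⟦2+⟧ k = trans (⟦suc⟧ (suc k)) (cong (_+ 1ℚ) (⟦suc⟧ k))

Q-recurrenceX : ∀ m n t → Q (2 ℕ.+ m) n t ≡ (1ℚ + 1ℚ) * Q (1 ℕ.+ m) n t - Q m n t
Q-recurrenceX m n t = begin
  quarticℚ ⟦ 2 ℕ.+ m ⟧ ⟦ n ⟧ t * ((+ 1) ℚ./ 144)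
    ≡⟨ cong (λ M → quarticℚ M ⟦ n ⟧ t * ((+ 1) ℚ./ 144)) (⟦2+⟧ m) ⟩
  quarticℚ (⟦ m ⟧ + 1ℚ + 1ℚ) ⟦ n ⟧ t * ((+ 1) ℚ./ 144)
    ≡⟨ affine ⟦ m ⟧ ⟦ n ⟧ t ⟩
  (1ℚ + 1ℚ) * (quarticℚ (⟦ m ⟧ + 1ℚ) ⟦ n ⟧ t * ((+ 1) ℚ./ 144)) - quarticℚ ⟦ m ⟧ ⟦ n ⟧ t * ((+ 1) ℚ./ 144)
    ≡⟨ cong (λ M → (1ℚ + 1ℚ) * (quarticℚ M ⟦ n ⟧ t * ((+ 1) ℚ./ 144)) - Q m n t) (⟦suc⟧ m) ⟨
  (1ℚ + 1ℚ) * Q (1 ℕ.+ m) n t - Q m n t ∎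
  where
  open ≡-Reasoning
  affine : ∀ M N t → quarticℚ (M + 1ℚ + 1ℚ) N t * ((+ 1) ℚ./ 144)
                     ≡ (1ℚ + 1ℚ) * (quarticℚ (M + 1ℚ) N t * ((+ 1) ℚ./ 144)) - quarticℚ M N t * ((+ 1) ℚ./ 144)
  affine = solve 3 (λ M N t → (quarticᴱ (M ⊕ Κ 1ℚ ⊕ Κ 1ℚ) N t ⊗ Κ ((+ 1) ℚ./ 144))
                            ⊜ ((Κ 1ℚ ⊕ Κ 1ℚ) ⊗ (quarticᴱ (M ⊕ Κ 1ℚ) N t ⊗ Κ ((+ 1) ℚ./ 144)) ⊖ quarticᴱ M N t ⊗ Κ ((+ 1) ℚ./ 144))) refl

Q-recurrenceY : ∀ m n t → Q m (2 ℕ.+ n) t ≡ (1ℚ + 1ℚ) * Q m (1 ℕ.+ n) t - Q m n t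
Q-recurrenceY m n t = begin
  quarticℚ ⟦ m ⟧ ⟦ 2 ℕ.+ n ⟧ t * ((+ 1) ℚ./ 144)
    ≡⟨ cong (λ N → quarticℚ ⟦ m ⟧ N t * ((+ 1) ℚ./ 144)) (⟦2+⟧ n) ⟩
  quarticℚ ⟦ m ⟧ (⟦ n ⟧ + 1ℚ + 1ℚ) t * ((+ 1) ℚ./ 144)
    ≡⟨ affine ⟦ m ⟧ ⟦ n ⟧ t ⟩
  (1ℚ + 1ℚ) * (quarticℚ ⟦ m ⟧ (⟦ n ⟧ + 1ℚ) t * ((+ 1) ℚ./ 144)) - quarticℚ ⟦ m ⟧ ⟦ n ⟧ t * ((+ 1) ℚ./ 144)
    ≡⟨ cong (λ N → (1ℚ + 1ℚ) * (quarticℚ ⟦ m ⟧ N t * ((+ 1) ℚ./ 144)) - Q m n t) (⟦suc⟧ n) ⟨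
  (1ℚ + 1ℚ) * Q m (1 ℕ.+ n) t - Q m n t ∎
  where
  open ≡-Reasoning
  affine : ∀ M N t → quarticℚ M (N + 1ℚ + 1ℚ) t * ((+ 1) ℚ./ 144)
                     ≡ (1ℚ + 1ℚ) * (quarticℚ M (N + 1ℚ) t * ((+ 1) ℚ./ 144)) - quarticℚ M N t * ((+ 1) ℚ./ 144)
  affine = solve 3 (λ M N t → (quarticᴱ M (N ⊕ Κ 1ℚ ⊕ Κ 1ℚ) t ⊗ Κ ((+ 1) ℚ./ 144))
                            ⊜ ((Κ 1ℚ ⊕ Κ 1ℚ) ⊗ (quarticᴱ M (N ⊕ Κ 1ℚ) t ⊗ Κ ((+ 1) ℚ./ 144)) ⊖ quarticᴱ M N t ⊗ Κ ((+ 1) ℚ./ 144))) refl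

Recurrence : ℚ → (ℕ → ℚ) → Set
Recurrence c x = ∀ k → x (2 ℕ.+ k) ≡ (c + c) * x (1 ℕ.+ k) - (c * c) * x k

Affine : (ℕ → ℚ) → Set
Affine q = ∀ k → q (2 ℕ.+ k) ≡ (1ℚ + 1ℚ) * q (1 ℕ.+ k) - q k

recurrence-unique : ∀ {c x y} → Recurrence c x → Recurrence c y → x 0 ≡ y 0 → x 1 ≡ y 1 → ∀ k → x k ≡ y k
recurrence-unique {c} {x} {y} rx ry x₀≡y₀ x₁≡y₁ = agree
  where
  agree : ∀ k → x k ≡ y k
  agree zero          = x₀≡y₀
  agree (suc zero)    = x₁≡y₁
  agree (suc (suc k)) = trans (rx k) (trans (cong₂ (λ u v → (c + c) * u - (c * c) * v) (agree (suc k)) (agree k)) (sym (ry k)))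

recurrence-scale : ∀ {c x} (p : ℚ) → Recurrence c x → Recurrence c (λ k → p * x k)
recurrence-scale {c} {x} p rx k = trans (cong (p *_) (rx k)) (distribute c p (x (1 ℕ.+ k)) (x k))
  where
  distribute : ∀ c p x₁ x₀ → p * ((c + c) * x₁ - (c * c) * x₀) ≡ (c + c) * (p * x₁) - (c * c) * (p * x₀)
  distribute = solve-∀ ℚ-ring

recurrence-geometric : ∀ c (p q : ℕ → ℚ) → (∀ k → p (suc k) ≡ c * p k) → Affine q → Recurrence c (λ k → p k * q k)
recurrence-geometric c p q pₛ affine k = begin
  p (2 ℕ.+ k) * q (2 ℕ.+ k)                                    ≡⟨ cong₂ _*_ (trans (pₛ (suc k)) (cong (c *_) (pₛ k))) (affine k) ⟩
  c * (c * p k) * ((1ℚ + 1ℚ) * q (1 ℕ.+ k) - q k)              ≡⟨ expand c (p k) (q (1 ℕ.+ k)) (q k) ⟩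
  (c + c) * ((c * p k) * q (1 ℕ.+ k)) - (c * c) * (p k * q k)  ≡⟨ cong (λ z → (c + c) * (z * q (1 ℕ.+ k)) - (c * c) * (p k * q k)) (pₛ k) ⟨
  (c + c) * (p (1 ℕ.+ k) * q (1 ℕ.+ k)) - (c * c) * (p k * q k) ∎
  where
  open ≡-Reasoning
  expand : ∀ c p q₁ q₀ → c * (c * p) * ((1ℚ + 1ℚ) * q₁ - q₀) ≡ (c + c) * ((c * p) * q₁) - (c * c) * (p * q₀)
  expand = solve-∀ ℚ-ring

recurrence-next : ∀ c p {d₀ d₁ d₂ q₀ q₁ q₂} → d₂ ≡ (c + c) * d₁ - (c * c) * d₀ →
  d₁ ≡ p * q₁ → c * c * d₀ ≡ (c * p) * q₀ → q₂ ≡ (1ℚ + 1ℚ) * q₁ - q₀ → d₂ ≡ (c * p) * q₂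
recurrence-next c p {d₀} {d₁} {d₂} {q₀} {q₁} {q₂} step d₁≡ d₀≡ q₂≡ = begin
  d₂                                        ≡⟨ step ⟩
  (c + c) * d₁ - (c * c) * d₀               ≡⟨ cong₂ (λ u v → (c + c) * u - v) d₁≡ d₀≡ ⟩
  (c + c) * (p * q₁) - (c * p) * q₀         ≡⟨ factor c p q₁ q₀ ⟩
  (c * p) * ((1ℚ + 1ℚ) * q₁ - q₀)           ≡⟨ cong ((c * p) *_) q₂≡ ⟨
  (c * p) * q₂                              ∎
  where
  open ≡-Reasoning
  factor : ∀ c p q₁ q₀ → (c + c) * (p * q₁) - (c * p) * q₀ ≡ (c * p) * ((1ℚ + 1ℚ) * q₁ - q₀)
  factor = solve-∀ ℚ-ring

χ-recurrenceX : ∀ m n t → χ (3 ℕ.+ m) n t ≡ (θ t + θ t) * χ (2 ℕ.+ m) n t - (θ t * θ t) * χ (1 ℕ.+ m) n t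
χ-recurrenceX m n = χ′-recurrenceX m (m ℕ.+ n)

χ-recurrenceY : ∀ m n t → χ m (3 ℕ.+ n) t ≡ (θ t + θ t) * χ m (2 ℕ.+ n) t - (θ t * θ t) * χ m (1 ℕ.+ n) t
χ-recurrenceY m n t = begin
  χ′ m (m ℕ.+ suc (suc (suc n))) t
    ≡⟨ cong (λ N → χ′ m N t) (+-suc² m (suc n)) ⟩
  χ′ m (2 ℕ.+ (m ℕ.+ suc n)) t
    ≡⟨ χ′-recurrenceY m (m ℕ.+ suc n) t (m<m+n m (s≤s z≤n)) ⟩
  (θ t + θ t) * χ′ m (suc (m ℕ.+ suc n)) t - (θ t * θ t) * χ m (1 ℕ.+ n) t
    ≡⟨ cong (λ N → (θ t + θ t) * χ′ m N t - (θ t * θ t) * χ m (1 ℕ.+ n) t) (+-suc m (suc n)) ⟨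
  (θ t + θ t) * χ m (2 ℕ.+ n) t - (θ t * θ t) * χ m (1 ℕ.+ n) t ∎
  where
  open ≡-Reasoning
  +-suc² : ∀ m k → m ℕ.+ suc (suc k) ≡ suc (suc (m ℕ.+ k))
  +-suc² m k = trans (+-suc m (suc k)) (cong suc (+-suc m k))
θᴱ : ∀ {k} → Expr ℚ k → Expr ℚ k
θᴱ t = t ⊕ Κ ½

χᴱ : ∀ {k} → ℕ → ℕ → Expr ℚ k → Expr ℚ k
χᴱ m n t = detᴱ (λ i j → θᴱ t ⊗ Κ (basis i j) ⊕ Κ (kindPattern {m ℕ.+ n} (kindOf m ∘ toℕ) i j))

Qᴱ : ∀ {k} → ℕ → ℕ → Expr ℚ k → Expr ℚ k
Qᴱ m n t = quarticᴱ (Κ ⟦ m ⟧) (Κ ⟦ n ⟧) t ⊗ Κ ((+ 1) ℚ./ 144)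

-- For m = 1 or n = 1 the pattern is not that of a connected graph; these values enter the
-- recurrences only multiplied by θ², hence the θ²-scaled statements.
base₁₁ : ∀ t → θ t * θ t * χ 1 1 t ≡ θ t ^ 0 * Q 1 1 t
base₁₁ = solve 1 (λ t → (θᴱ t ⊗ θᴱ t ⊗ χᴱ 1 1 t) ⊜ (powᴱ (θᴱ t) 0 ⊗ Qᴱ 1 1 t)) refl

base₂₁ : ∀ t → θ t * θ t * χ 2 1 t ≡ θ t ^ 1 * Q 2 1 t
base₂₁ = solve 1 (λ t → (θᴱ t ⊗ θᴱ t ⊗ χᴱ 2 1 t) ⊜ (powᴱ (θᴱ t) 1 ⊗ Qᴱ 2 1 t)) refl

base₁₂ : ∀ t → θ t * θ t * χ 1 2 t ≡ (θ t * θ t ^ 0) * Q 1 2 t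
base₁₂ = solve 1 (λ t → (θᴱ t ⊗ θᴱ t ⊗ χᴱ 1 2 t) ⊜ (θᴱ t ⊗ powᴱ (θᴱ t) 0 ⊗ Qᴱ 1 2 t)) refl

base₂₂ : ∀ t → χ 2 2 t ≡ θ t ^ 0 * Q 2 2 t
base₂₂ = solve 1 (λ t → χᴱ 2 2 t ⊜ (powᴱ (θᴱ t) 0 ⊗ Qᴱ 2 2 t)) refl

closedForm-n≡1 : ∀ a t → θ t * θ t * χ (suc a) 1 t ≡ θ t ^ a * Q (suc a) 1 t
closedForm-n≡1 a t = recurrence-unique {θ t} {x = λ k → θ t * θ t * χ (suc k) 1 t} {y = λ k → θ t ^ k * Q (suc k) 1 t}
  (recurrence-scale {θ t} {λ k → χ (suc k) 1 t} (θ t * θ t) λ k → χ-recurrenceX k 1 t)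
  (recurrence-geometric (θ t) (θ t ^_) (λ k → Q (suc k) 1 t) (λ _ → refl) λ k → Q-recurrenceX (suc k) 1 t)
  (base₁₁ t) (base₂₁ t) a

closedForm-n≡2 : ∀ a t → χ (2 ℕ.+ a) 2 t ≡ θ t ^ a * Q (2 ℕ.+ a) 2 t
closedForm-n≡2 a t = recurrence-unique {θ t} {x = λ k → χ (2 ℕ.+ k) 2 t} {y = λ k → θ t ^ k * Q (2 ℕ.+ k) 2 t}
  (λ k → χ-recurrenceX (1 ℕ.+ k) 2 t)
  (recurrence-geometric (θ t) (θ t ^_) (λ k → Q (2 ℕ.+ k) 2 t) (λ _ → refl) λ k → Q-recurrenceX (2 ℕ.+ k) 2 t)
  (base₂₂ t)
  (recurrence-next (θ t) (θ t ^ 0) {q₀ = Q 1 2 t} {q₁ = Q 2 2 t} (χ-recurrenceX 0 2 t) (base₂₂ t) (base₁₂ t) (Q-recurrenceX 1 2 t))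
  a

closedForm-n≡3 : ∀ a t → χ (2 ℕ.+ a) 3 t ≡ θ t ^ (1 ℕ.+ a) * Q (2 ℕ.+ a) 3 t
closedForm-n≡3 a t = recurrence-next (θ t) (θ t ^ a) {q₀ = Q (2 ℕ.+ a) 1 t} {q₁ = Q (2 ℕ.+ a) 2 t}
  (χ-recurrenceY (2 ℕ.+ a) 0 t) (closedForm-n≡2 a t) (closedForm-n≡1 (1 ℕ.+ a) t) (Q-recurrenceY (2 ℕ.+ a) 1 t)

closedForm : ∀ a b t → χ (2 ℕ.+ a) (2 ℕ.+ b) t ≡ θ t ^ (b ℕ.+ a) * Q (2 ℕ.+ a) (2 ℕ.+ b) t
closedForm a b t = recurrence-unique {θ t} {x = λ k → χ (2 ℕ.+ a) (2 ℕ.+ k) t} {y = λ k → θ t ^ (k ℕ.+ a) * Q (2 ℕ.+ a) (2 ℕ.+ k) t}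
  (λ k → χ-recurrenceY (2 ℕ.+ a) (1 ℕ.+ k) t)
  (recurrence-geometric (θ t) (λ k → θ t ^ (k ℕ.+ a)) (λ k → Q (2 ℕ.+ a) (2 ℕ.+ k) t) (λ _ → refl) λ k → Q-recurrenceY (2 ℕ.+ a) (2 ℕ.+ k) t)
  (closedForm-n≡2 a t) (closedForm-n≡3 a t) b

-- Distances in K_{m,n} ∖ e

anyFin-true : ∀ {N} (p : Fin N → Bool) w → p w ≡ true → anyFin p ≡ true
anyFin-true p zero    pw = cong (_∨ anyFin (p ∘ suc)) pw
anyFin-true p (suc w) pw = trans (cong (p zero ∨_) (anyFin-true (p ∘ suc) w pw)) (∨-zeroʳ (p zero))

anyFin-false : ∀ {N} (p : Fin N → Bool) → (∀ l → p l ≡ false) → anyFin p ≡ false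
anyFin-false {zero}  p p≗false = refl
anyFin-false {suc N} p p≗false = cong₂ _∨_ (p≗false zero) (anyFin-false (p ∘ suc) (p≗false ∘ suc))

anyFin-select : ∀ {N} (i : Fin N) (p : Fin N → Bool) → anyFin (λ l → (i == l) ∧ p l) ≡ p i
anyFin-select zero    p = trans (cong (p zero ∨_) (anyFin-false (λ k → (zero == suc k) ∧ p (suc k)) (λ _ → refl))) (∨-identityʳ (p zero))
anyFin-select (suc i) p = anyFin-select i (p ∘ suc)

reach-1 : ∀ {N} (G : Graph N) i j → reach G 1 i j ≡ (i == j) ∨ G i j
reach-1 G i j = cong ((i == j) ∨_) (anyFin-select i (λ l → G l j))

reach-step : ∀ {N} (G : Graph N) k {i} l {j} → reach G k i l ≡ true → G l j ≡ true → reach G (suc k) i j ≡ true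
reach-step G k {i} l {j} i⇝l l~j =
  trans (cong (reach G k i j ∨_) (anyFin-true (λ l → reach G k i l ∧ G l j) l (cong₂ _∧_ i⇝l l~j)))
        (∨-zeroʳ (reach G k i j))

reach-antitone : ∀ {N} (G : Graph N) {i j k d} → k ≤ d → reach G d i j ≡ false → reach G k i j ≡ false
reach-antitone G {i} {j} {k} {d} k≤d unreached = below (d ℕ.∸ k) (subst (λ e → reach G e i j ≡ false) (sym (m∸n+n≡m k≤d)) unreached)
  where
  below : ∀ e → reach G (e ℕ.+ k) i j ≡ false → reach G k i j ≡ false
  below zero    u = u
  below (suc e) u = below e (∨-conicalˡ _ _ u)

search-from : ∀ (p : ℕ → Bool) s f d → (∀ k → k < d → p (s ℕ.+ k) ≡ false) → p (s ℕ.+ d) ≡ true → d < f →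
  search p s f ≡ s ℕ.+ d
search-from p s (suc f) zero before found _ with p s | trans (cong p (sym (+-identityʳ s))) found
... | true | _ = sym (+-identityʳ s)
search-from p s (suc f) (suc d) before found (s≤s d<f) with p s | trans (cong p (sym (+-identityʳ s))) (before 0 (s≤s z≤n))
... | false | _ = trans (search-from p (suc s) f d (λ k k<d → trans (cong p (sym (+-suc s k))) (before (suc k) (s≤s k<d)))
                                                (trans (cong p (sym (+-suc s d))) found) d<f)
                        (sym (+-suc s d))

dist-≡ : ∀ {N} (G : Graph N) {i j} d → reach G d i j ≡ false → reach G (suc d) i j ≡ true → suc d < N → dist G i j ≡ suc d
dist-≡ {N} G {i} {j} d unreached reached d<N =
  search-from (λ k → reach G k i j) 0 N (suc d) (λ k k<d → reach-antitone G (ℕ.≤-pred k<d) unreached) reached d<N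

walk₂-keepsSide : ∀ κ λ′ κ′ → (inX κ xor inX κ′) ≡ true → adjacent κ λ′ ∧ adjacent λ′ κ′ ≡ false
walk₂-keepsSide (kind true  _ _) (kind true  _ _) (kind false _ _) _ = refl
walk₂-keepsSide (kind true  _ _) (kind false _ _) (kind false _ _) _ = ∧-zeroʳ _
walk₂-keepsSide (kind false _ _) (kind false _ _) (kind true  _ _) _ = refl
walk₂-keepsSide (kind false _ _) (kind true  _ _) (kind true  _ _) _ = ∧-zeroʳ _

adjacent-ordinary : ∀ κ s → adjacent κ (kind s false false) ≡ inX κ xor s
adjacent-ordinary κ s rewrite ∧-zeroʳ (isX₀ κ) = ∧-identityʳ _

ordinary-adjacent : ∀ s κ → adjacent (kind s false false) κ ≡ s xor inX κ
ordinary-adjacent s κ rewrite ∧-zeroʳ (isX₀ κ) = ∧-identityʳ _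

kindDist-diag : ∀ κ → kindDist κ κ ≡ 2
kindDist-diag (kind true  _ _) = refl
kindDist-diag (kind false _ _) = refl

module KmnMinusE-distances (a b : ℕ) where

  m n : ℕ
  m = 2 ℕ.+ a
  n = 2 ℕ.+ b

  G : Graph (m ℕ.+ n)
  G = KmnMinusE m n

  κ : Fin (m ℕ.+ n) → Kind
  κ = kindOf m ∘ toℕ

  ordinaryVertex : Bool → Fin (m ℕ.+ n)
  ordinaryVertex true  = suc zero
  ordinaryVertex false = m ↑ʳ suc zero

  κ-ordinaryVertex : ∀ s → κ (ordinaryVertex s) ≡ kind s false false
  κ-ordinaryVertex true  = refl
  κ-ordinaryVertex false = trans (cong (kindOf m) (toℕ-↑ʳ m (suc zero))) (kindOf-beyond (m<m+n m (s≤s z≤n)))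

  to-ordinary : ∀ i s → G i (ordinaryVertex s) ≡ inX (κ i) xor s
  to-ordinary i s = trans (cong (adjacent (κ i)) (κ-ordinaryVertex s)) (adjacent-ordinary (κ i) s)

  from-ordinary : ∀ s j → G (ordinaryVertex s) j ≡ s xor inX (κ j)
  from-ordinary s j = trans (cong (λ κ′ → adjacent κ′ (κ j)) (κ-ordinaryVertex s)) (ordinary-adjacent s (κ j))

  sameSide-reach₂ : ∀ i j → (inX (κ i) xor inX (κ j)) ≡ false → reach G 2 i j ≡ true
  sameSide-reach₂ i j sameSide = reach-step G 1 {i} l {j} i⇝l l~j
    where
    s : Bool
    s = not (inX (κ i))
    l : Fin (m ℕ.+ n)
    l = ordinaryVertex s
    i~l : G i l ≡ true
    i~l = trans (to-ordinary i s) (trans (sym (not-distribʳ-xor (inX (κ i)) (inX (κ i)))) (cong not (xor-same (inX (κ i)))))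
    i⇝l : reach G 1 i l ≡ true
    i⇝l = trans (reach-1 G i l) (trans (cong ((i == l) ∨_) i~l) (∨-zeroʳ (i == l)))
    l~j : G l j ≡ true
    l~j = trans (from-ordinary s j) (trans (sym (not-distribˡ-xor (inX (κ i)) (inX (κ j)))) (cong not sameSide))

  3<m+n : 3 < m ℕ.+ n
  3<m+n = s≤s (s≤s (≤-trans (s≤s (s≤s z≤n)) (m≤n+m n a)))

  dist-KmnMinusE : ∀ i j → (i == j) ≡ false → dist G i j ≡ kindDist (κ i) (κ j)
  dist-KmnMinusE i j i≢j = byCases (adjacent (κ i) (κ j)) (inX (κ i) xor inX (κ j)) refl refl
    where
    kindDist≡ : ∀ {e f} → adjacent (κ i) (κ j) ≡ e → (inX (κ i) xor inX (κ j)) ≡ f →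
                kindDist (κ i) (κ j) ≡ (if e then 1 else if f then 3 else 2)
    kindDist≡ adj sides = cong₂ (λ e f → if e then 1 else if f then 3 else 2) adj sides
    unreached₁ : adjacent (κ i) (κ j) ≡ false → reach G 1 i j ≡ false
    unreached₁ adj = trans (reach-1 G i j) (cong₂ _∨_ i≢j adj)
    noWalk : adjacent (κ i) (κ j) ≡ false → (inX (κ i) xor inX (κ j)) ≡ true → ∀ l → reach G 1 i l ∧ G l j ≡ false
    noWalk adj sides l = trans (cong (_∧ G l j) (reach-1 G i l)) (byEq (i == l) refl)
      where
      byEq : ∀ e → (i == l) ≡ e → ((i == l) ∨ G i l) ∧ G l j ≡ false
      byEq true  i≡l = trans (cong (λ e → (e ∨ G i l) ∧ G l j) i≡l) (trans (cong (λ l′ → G l′ j) (sym (==⇒≡ {i = i} {j = l} i≡l))) adj)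
      byEq false i≢l = trans (cong (λ e → (e ∨ G i l) ∧ G l j) i≢l) (walk₂-keepsSide (κ i) (κ l) (κ j) sides)
    byCases : ∀ e f → adjacent (κ i) (κ j) ≡ e → (inX (κ i) xor inX (κ j)) ≡ f → dist G i j ≡ kindDist (κ i) (κ j)
    byCases true  f     adj sides = trans (dist-≡ G {i} {j} 0 i≢j (trans (reach-1 G i j) (cong₂ _∨_ i≢j adj)) (s≤s (s≤s z≤n)))
                                          (sym (kindDist≡ adj sides))
    byCases false false adj sides = trans (dist-≡ G {i} {j} 1 (unreached₁ adj) (sameSide-reach₂ i j sides) (<⇒≤ 3<m+n))
                                          (sym (kindDist≡ adj sides))
    byCases false true  adj sides = trans (dist-≡ G {i} {j} 2 unreached₂ reached₃ 3<m+n) (sym (kindDist≡ adj sides))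
      where
      unreached₂ : reach G 2 i j ≡ false
      unreached₂ = cong₂ _∨_ (unreached₁ adj) (anyFin-false (λ l → reach G 1 i l ∧ G l j) (noWalk adj sides))
      l : Fin (m ℕ.+ n)
      l = ordinaryVertex (inX (κ i))
      reached₃ : reach G 3 i j ≡ true
      reached₃ = reach-step G 2 {i} l {j}
        (sameSide-reach₂ i l (trans (cong (λ κ′ → inX (κ i) xor inX κ′) (κ-ordinaryVertex (inX (κ i)))) (xor-same (inX (κ i)))))
        (trans (from-ordinary (inX (κ i)) j) sides)

charPoly-KmnMinusE : ∀ a b t → charPoly (RD (KmnMinusE (2 ℕ.+ a) (2 ℕ.+ b))) t ≡ χ (2 ℕ.+ a) (2 ℕ.+ b) t
charPoly-KmnMinusE a b t = det-cong λ i j → entry i j (i == j) refl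
  where
  open KmnMinusE-distances a b
  diagonal : ∀ t → t - 0ℚ ≡ (t + ½) * 1ℚ + - ½
  diagonal = solve-∀ ℚ-ring
  offDiagonal : ∀ c x → 0ℚ - x ≡ c * 0ℚ + - x
  offDiagonal = solve-∀ ℚ-ring
  entry : ∀ i j e → (i == j) ≡ e →
    (if i == j then t else 0ℚ) - (if i == j then 0ℚ else recip (dist G i j))
      ≡ θ t * (if i == j then 1ℚ else 0ℚ) + - recip (kindDist (κ i) (κ j))
  entry i j true  i≡j = begin
    (if i == j then t else 0ℚ) - (if i == j then 0ℚ else recip (dist G i j))
      ≡⟨ cong (λ e → (if e then t else 0ℚ) - (if e then 0ℚ else recip (dist G i j))) i≡j ⟩
    t - 0ℚ                                    ≡⟨ diagonal t ⟩
    θ t * 1ℚ + - recip 2                      ≡⟨ cong₂ (λ e d → θ t * (if e then 1ℚ else 0ℚ) + - recip d) i≡j diag ⟨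
    θ t * (if i == j then 1ℚ else 0ℚ) + - recip (kindDist (κ i) (κ j)) ∎
    where
    open ≡-Reasoning
    diag : kindDist (κ i) (κ j) ≡ 2
    diag = trans (cong (λ k → kindDist (κ i) (κ k)) (sym (==⇒≡ {i = i} {j = j} i≡j))) (kindDist-diag (κ i))
  entry i j false i≢j = begin
    (if i == j then t else 0ℚ) - (if i == j then 0ℚ else recip (dist G i j))
      ≡⟨ cong (λ e → (if e then t else 0ℚ) - (if e then 0ℚ else recip (dist G i j))) i≢j ⟩
    0ℚ - recip (dist G i j)                   ≡⟨ offDiagonal (θ t) _ ⟩
    θ t * 0ℚ + - recip (dist G i j)           ≡⟨ cong₂ (λ e d → θ t * (if e then 1ℚ else 0ℚ) + - recip d) (sym i≢j) (dist-KmnMinusE i j i≢j) ⟩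
    θ t * (if i == j then 1ℚ else 0ℚ) + - recip (kindDist (κ i) (κ j)) ∎
    where open ≡-Reasoning

size : ∀ a b → (2 ℕ.+ a ℕ.+ (2 ℕ.+ b)) ∸ 4 ≡ b ℕ.+ a
size a b = trans (cong (_∸ 2) (trans (+-suc a (ℕ.suc b)) (cong ℕ.suc (+-suc a b)))) (+-comm a b)

lemma9 : (m n : ℕ) → 2 ≤ m → 2 ≤ n → (t : ℚ) →
    charPoly (RD (KmnMinusE m n)) t
    ≡ (t + (+ 1) ℚ./ 2) ^ ((m ℕ.+ n) ∸ 4) * (quartic m n t * ((+ 1) ℚ./ 144))
lemma9 .(2 ℕ.+ a) .(2 ℕ.+ b) (s≤s (s≤s {n = a} z≤n)) (s≤s (s≤s {n = b} z≤n)) t = begin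
  charPoly (RD (KmnMinusE (2 ℕ.+ a) (2 ℕ.+ b))) t             ≡⟨ charPoly-KmnMinusE a b t ⟩
  χ (2 ℕ.+ a) (2 ℕ.+ b) t                                     ≡⟨ closedForm a b t ⟩
  θ t ^ (b ℕ.+ a) * Q (2 ℕ.+ a) (2 ℕ.+ b) t                   ≡⟨ cong (λ e → θ t ^ e * Q (2 ℕ.+ a) (2 ℕ.+ b) t) (size a b) ⟨
  θ t ^ ((2 ℕ.+ a ℕ.+ (2 ℕ.+ b)) ∸ 4) * Q (2 ℕ.+ a) (2 ℕ.+ b) t ∎
  where open ≡-Reasoning
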